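{- Let $q>1$ and $n\geq 1$. The maximum success probability of any restricted strategy for the New Hats-on-a-line Game with $q$ hat colours and $n$ players is $1-\left(\frac{q-1}{q}\right)^{n}$.
   Context: The New Hats-on-a-line Game with $q$ hat colours and $n$ players: players $P_1,\dots,P_n$ stand in a line. Each player receives a hat whose colour is chosen uniformly at random from a fixed set of $q$ colours, independently of the other hats. Player $P_i$ sees exactly the hats of $P_{i+1},\dots,P_n$. The players respond one at a time in the order $P_1,P_2,\dots,P_n$; each response is either a guess of the player's own hat colour or a pass, and every player hears all earlier responses. Apart from agreeing on a strategy beforehand, no communication is allowed. A (deterministic) strategy specifies, for each player, the response as a function of the hats that player sees and the responses that player has heard. The players win if at least one player guesses correctly and no player guesses incorrectly; the success probability of a strategy is the probability of winning over the random hat assignment. A strategy is called restricted if, for every hat configuration, any guess made by any player other than $P_1$ is correct. -}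

module Defs where

open import Data.Nat using (ℕ; zero; suc; _^_; _<_)
open import Data.Fin using (Fin; zero; suc; toℕ; _≟_)
open import Data.Maybe using (Maybe; just; nothing)
open import Data.Vec using (Vec; []; _∷_; _∷ʳ_; lookup)
open import Data.List using (List; [_]; concatMap; map; allFin; filter; length)
open import Data.Product using (_×_; _,_; Σ; ∃)
open import Data.Unit using (⊤; tt)
open import Data.Bool using (Bool; true; false; _∧_; _∨_; T; T?)
open import Data.Integer using (+_)
open import Data.Rational using (ℚ; 0ℚ; 1ℚ; _/_; _*_; _-_)
open import Relation.Nullary using (does)
open import Relation.Binary.PropositionalEquality using (_≡_)

-- A response: nothing = pass, just c = guess colour c.
Response : ℕ → Set
Response q = Maybe (Fin q)

-- Strategy for a block of m remaining players, preceded by k players.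
-- The first player of the block sees the responses of the k earlier
-- players (in order P_1,...,P_k) and the m-1 hats of the players behind him.
Strat : (q m k : ℕ) → Set
Strat q zero    k = ⊤
Strat q (suc m) k = (Vec (Response q) k → Vec (Fin q) m → Response q) × Strat q m (suc k)

Strategy : (q n : ℕ) → Set
Strategy q n = Strat q n 0

run : ∀ {q m k} → Strat q m k → Vec (Response q) k → Vec (Fin q) m → Vec (Response q) m
run {m = zero}  _       h []       = []
run {m = suc m} (f , s) h (c ∷ cs) = let r = f h cs in r ∷ run s (h ∷ʳ r) cs

responses : ∀ {q n} → Strategy q n → Vec (Fin q) n → Vec (Response q) n
responses s cfg = run s [] cfg

noWrong : ∀ {q m} → Vec (Fin q) m → Vec (Response q) m → Bool
noWrong []       []             = true
noWrong (c ∷ cs) (nothing ∷ rs) = noWrong cs rs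
noWrong (c ∷ cs) (just g ∷ rs)  = does (g ≟ c) ∧ noWrong cs rs

someRight : ∀ {q m} → Vec (Fin q) m → Vec (Response q) m → Bool
someRight []       []             = false
someRight (c ∷ cs) (nothing ∷ rs) = someRight cs rs
someRight (c ∷ cs) (just g ∷ rs)  = does (g ≟ c) ∨ someRight cs rs

wins : ∀ {q n} → Strategy q n → Vec (Fin q) n → Bool
wins s cfg = noWrong cfg (responses s cfg) ∧ someRight cfg (responses s cfg)

allConfigs : (q n : ℕ) → List (Vec (Fin q) n)
allConfigs q zero    = [ [] ]
allConfigs q (suc n) = concatMap (λ c → map (c ∷_) (allConfigs q n)) (allFin q)

winCount : ∀ {q n} → Strategy q n → ℕ
winCount {q} {n} s = length (filter (λ cfg → T? (wins s cfg)) (allConfigs q n))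

-- a / d as a rational (0 when d = 0; never used with d = 0 below).
frac : ℕ → ℕ → ℚ
frac a zero    = 0ℚ
frac a (suc d) = + a / suc d

successProb : ∀ {q n} → Strategy q n → ℚ
successProb {q} {n} s = frac (winCount s) (q ^ n)

powℚ : ℚ → ℕ → ℚ
powℚ p zero    = 1ℚ
powℚ p (suc n) = p * powℚ p n

Restricted : ∀ {q n} → Strategy q n → Set
Restricted {q} {n} s = (cfg : Vec (Fin q) n) (i : Fin n) (c : Fin q) →
  0 < toℕ i → lookup (responses s cfg) i ≡ just c → c ≡ lookup cfg i

-- At least (q-1)^n of the q^n hat configurations lose under ANY strategy, restricted or
-- not.  Induct on the first player P: fix the hats behind P.  If P passes, nobody learns P's
-- hat, so the outcome is that of the remaining players' strategy after hearing a pass, for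
-- each of the q colours of P's hat; if P guesses, all but one of the q colours lose.  Hence
-- the losses of an (m+1)-player strategy are at least (q-1) times the losses of an m-player
-- strategy.  The bound is attained when the first player who has heard only passes and sees
-- only non-zero hats guesses colour 0: then exactly the configurations without a 0 lose, and
-- a later player guesses only when its predecessor saw a 0 but it sees none, so its hat is 0.

module Submission where

open import Defs
open import Data.Nat using (ℕ; zero; suc; _+_; _*_; _∸_; _^_; _≤_; _<_; z≤n; NonZero)
open import Data.Nat.Properties hiding (_≟_)
open import Data.Nat.ListAction using (sum)
open import Data.Nat.ListAction.Properties using (sum-++)
open import Data.Fin using (Fin; zero; suc; punchIn; _≟_)
open import Data.Fin.Properties using (punchInᵢ≢i)
open import Data.Vec using (Vec; []; _∷_; _∷ʳ_; replicate; lookup)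
open import Data.Vec.Properties using (lookup-replicate)
open import Data.Product using (_×_; Σ; _,_)
open import Data.Unit using (tt)
import Data.List as List
open import Data.List using (List; map; filter; length; concatMap; tabulate; allFin)
open import Data.List.Properties using (map-++; map-∘)
open import Data.Bool using (Bool; true; false; not; T?; _∧_; if_then_else_)
open import Data.Bool.Properties using (∧-identityʳ; ∧-assoc; ∧-zeroʳ; ∧-conicalˡ)
open import Data.Maybe using (just; nothing; is-nothing)
open import Data.Maybe.Properties using (just-injective)
import Data.Integer as ℤ
open import Data.Integer.Properties using (pos-+; pos-*; *-monoʳ-≤-nonNeg)
open import Data.Integer.Tactic.RingSolver using (solve-∀)
open import Data.Rational using (1ℚ; _-_; toℚᵘ)
import Data.Rational
import Data.Rational as ℚ
open import Data.Rational.Properties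
  using (toℚᵘ-fromℚᵘ; toℚᵘ-homo-*; toℚᵘ-homo-+; toℚᵘ-homo‿-; toℚᵘ-injective; toℚᵘ-cancel-≤)
  renaming (≤-refl to ≤ℚ-refl)
open import Data.Rational.Unnormalised using (mkℚᵘ; 1ℚᵘ; *≡*; *≤*)
  renaming (_≃_ to _≃ᵘ_; _+_ to _+ᵘ_; _-_ to _-ᵘ_; -_ to -ᵘ_; _*_ to _*ᵘ_)
open import Data.Rational.Unnormalised.Properties
  using (≃-refl; ≃-sym; *-cong; +-cong; -‿cong; ≤-respˡ-≃; ≤-respʳ-≃; module ≃-Reasoning)
open import Function using (_∘_; id)
open import Relation.Nullary using (yes; no; contradiction)
open import Relation.Binary.PropositionalEquality
open import Algebra.Properties.Semiring.Sum +-*-semiring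
  using (sum-syntax; sum-cong-≗; sum-remove; ∑-comm; ∑-distrib-+; *-distribˡ-sum)

𝟙 : Bool → ℕ
𝟙 false = 0
𝟙 true  = 1

𝟙≤1 : ∀ b → 𝟙 b ≤ 1
𝟙≤1 false = z≤n
𝟙≤1 true  = ≤-refl

∑-const : ∀ n k → ∑[ i < n ] k ≡ n * k
∑-const zero    k = refl
∑-const (suc n) k = cong (k +_) (∑-const n k)

∑-mono-≤ : ∀ {n} {f g : Fin n → ℕ} → (∀ i → f i ≤ g i) → ∑[ i < n ] f i ≤ ∑[ i < n ] g i
∑-mono-≤ {zero}  f≤g = z≤n
∑-mono-≤ {suc n} f≤g = +-mono-≤ (f≤g zero) (∑-mono-≤ (f≤g ∘ suc))

allButOne≥1⇒p≤∑ : ∀ {p} (f : Fin (suc p) → ℕ) (i : Fin (suc p)) → (∀ j → j ≢ i → 1 ≤ f j) → p ≤ ∑[ j < suc p ] f j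
allButOne≥1⇒p≤∑ {p} f i f≥1 = begin
  p                                   ≡⟨ sym (*-identityʳ p) ⟩
  p * 1                               ≡⟨ sym (∑-const p 1) ⟩
  ∑[ j < p ] 1                        ≤⟨ ∑-mono-≤ (λ j → f≥1 (punchIn i j) (punchInᵢ≢i i j)) ⟩
  ∑[ j < p ] f (punchIn i j)          ≤⟨ m≤n+m _ (f i) ⟩
  f i + ∑[ j < p ] f (punchIn i j)    ≡⟨ sym (sum-remove f) ⟩
  ∑[ j < suc p ] f j                  ∎
  where open ≤-Reasoning

sumConfigs : ∀ {q} n → (Vec (Fin q) n → ℕ) → ℕ
sumConfigs         zero    f = f []
sumConfigs {q = q} (suc n) f = ∑[ c < q ] sumConfigs n (λ cs → f (c ∷ cs))

module _ {q : ℕ} where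

  sumConfigs-cong : ∀ n {f g : Vec (Fin q) n → ℕ} → (∀ x → f x ≡ g x) → sumConfigs n f ≡ sumConfigs n g
  sumConfigs-cong zero    f≡g = f≡g []
  sumConfigs-cong (suc n) f≡g = sum-cong-≗ (λ c → sumConfigs-cong n (λ cs → f≡g (c ∷ cs)))

  sumConfigs-mono-≤ : ∀ n {f g : Vec (Fin q) n → ℕ} → (∀ x → f x ≤ g x) → sumConfigs n f ≤ sumConfigs n g
  sumConfigs-mono-≤ zero    f≤g = f≤g []
  sumConfigs-mono-≤ (suc n) f≤g = ∑-mono-≤ (λ c → sumConfigs-mono-≤ n (λ cs → f≤g (c ∷ cs)))

  sumConfigs-const : ∀ n k → sumConfigs {q} n (λ _ → k) ≡ q ^ n * k
  sumConfigs-const zero    k = sym (+-identityʳ k)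
  sumConfigs-const (suc n) k = begin
    ∑[ c < q ] sumConfigs n (λ _ → k)  ≡⟨ sum-cong-≗ {q} (λ _ → sumConfigs-const n k) ⟩
    ∑[ c < q ] (q ^ n * k)             ≡⟨ ∑-const q (q ^ n * k) ⟩
    q * (q ^ n * k)                    ≡⟨ sym (*-assoc q (q ^ n) k) ⟩
    q ^ suc n * k                      ∎
    where open ≡-Reasoning

  sumConfigs-+ : ∀ n (f g : Vec (Fin q) n → ℕ) → sumConfigs n (λ x → f x + g x) ≡ sumConfigs n f + sumConfigs n g
  sumConfigs-+ zero    f g = refl
  sumConfigs-+ (suc n) f g = trans (sum-cong-≗ {q} (λ c → sumConfigs-+ n (f ∘ (c ∷_)) (g ∘ (c ∷_))))
                                   (∑-distrib-+ (λ c → sumConfigs n (f ∘ (c ∷_))) (λ c → sumConfigs n (g ∘ (c ∷_))))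

  *-distribˡ-sumConfigs : ∀ n k (f : Vec (Fin q) n → ℕ) → sumConfigs n (λ x → k * f x) ≡ k * sumConfigs n f
  *-distribˡ-sumConfigs zero    k f = refl
  *-distribˡ-sumConfigs (suc n) k f = trans (sum-cong-≗ {q} (λ c → *-distribˡ-sumConfigs n k (f ∘ (c ∷_))))
                                    (sym (*-distribˡ-sum k (λ c → sumConfigs n (f ∘ (c ∷_)))))

  sumConfigs-∑-comm : ∀ n {m} (f : Fin m → Vec (Fin q) n → ℕ) →
    sumConfigs n (λ x → ∑[ i < m ] f i x) ≡ ∑[ i < m ] sumConfigs n (f i)
  sumConfigs-∑-comm zero    f = refl
  sumConfigs-∑-comm (suc n) f = trans (sum-cong-≗ {q} (λ c → sumConfigs-∑-comm n (λ i cs → f i (c ∷ cs))))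
                                      (∑-comm (λ c i → sumConfigs n (λ cs → f i (c ∷ cs))))

length-filter-T?≡sum-𝟙 : ∀ {A : Set} (b : A → Bool) xs → length (filter (T? ∘ b) xs) ≡ sum (map (𝟙 ∘ b) xs)
length-filter-T?≡sum-𝟙 b List.[] = refl
length-filter-T?≡sum-𝟙 b (x List.∷ xs) with b x
... | true  = cong suc (length-filter-T?≡sum-𝟙 b xs)
... | false = length-filter-T?≡sum-𝟙 b xs

sum-map-concatMap : ∀ {A B : Set} (f : B → ℕ) (g : A → List B) xs →
  sum (map f (concatMap g xs)) ≡ sum (map (sum ∘ map f ∘ g) xs)
sum-map-concatMap f g List.[]       = refl
sum-map-concatMap f g (x List.∷ xs) = begin
  sum (map f (g x List.++ concatMap g xs))          ≡⟨ cong sum (map-++ f (g x) _) ⟩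
  sum (map f (g x) List.++ map f (concatMap g xs))  ≡⟨ sum-++ (map f (g x)) _ ⟩
  sum (map f (g x)) + sum (map f (concatMap g xs))  ≡⟨ cong (sum (map f (g x)) +_) (sum-map-concatMap f g xs) ⟩
  sum (map f (g x)) + sum (map (sum ∘ map f ∘ g) xs) ∎
  where open ≡-Reasoning

sum-map-tabulate : ∀ {A : Set} {m} (f : A → ℕ) (g : Fin m → A) → sum (map f (tabulate g)) ≡ ∑[ i < m ] f (g i)
sum-map-tabulate {m = zero}  f g = refl
sum-map-tabulate {m = suc m} f g = cong (f (g zero) +_) (sum-map-tabulate f (g ∘ suc))

sum-map-allConfigs : ∀ {q} n (f : Vec (Fin q) n → ℕ) → sum (map f (allConfigs q n)) ≡ sumConfigs n f
sum-map-allConfigs         zero    f = +-identityʳ (f [])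
sum-map-allConfigs {q = q} (suc n) f = begin
  sum (map f (concatMap (λ c → map (c ∷_) (allConfigs q n)) (allFin q)))
    ≡⟨ sum-map-concatMap f (λ c → map (c ∷_) (allConfigs q n)) (allFin q) ⟩
  sum (map (λ c → sum (map f (map (c ∷_) (allConfigs q n)))) (allFin q))
    ≡⟨ sum-map-tabulate (λ c → sum (map f (map (c ∷_) (allConfigs q n)))) id ⟩
  ∑[ c < q ] sum (map f (map (c ∷_) (allConfigs q n)))
    ≡⟨ sum-cong-≗ {q} (λ c → trans (cong sum (sym (map-∘ (allConfigs q n)))) (sum-map-allConfigs n (f ∘ (c ∷_)))) ⟩
  ∑[ c < q ] sumConfigs n (λ cs → f (c ∷ cs)) ∎
  where open ≡-Reasoning

winCount≡sumConfigs : ∀ {q n} (s : Strategy q n) → winCount s ≡ sumConfigs n (𝟙 ∘ wins s)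
winCount≡sumConfigs {q} {n} s = trans (length-filter-T?≡sum-𝟙 (wins s) (allConfigs q n)) (sum-map-allConfigs n (𝟙 ∘ wins s))

𝟙-+-𝟙-not : ∀ b → 𝟙 b + 𝟙 (not b) ≡ 1
𝟙-+-𝟙-not false = refl
𝟙-+-𝟙-not true  = refl

sumConfigs-𝟙-+-𝟙-not : ∀ {q} n (b : Vec (Fin q) n → Bool) →
  sumConfigs n (𝟙 ∘ b) + sumConfigs n (𝟙 ∘ not ∘ b) ≡ q ^ n
sumConfigs-𝟙-+-𝟙-not {q} n b = begin
  sumConfigs n (𝟙 ∘ b) + sumConfigs n (𝟙 ∘ not ∘ b)  ≡⟨ sym (sumConfigs-+ n (𝟙 ∘ b) (𝟙 ∘ not ∘ b)) ⟩
  sumConfigs n (λ x → 𝟙 (b x) + 𝟙 (not (b x)))      ≡⟨ sumConfigs-cong n (𝟙-+-𝟙-not ∘ b) ⟩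
  sumConfigs n (λ _ → 1)                             ≡⟨ sumConfigs-const n 1 ⟩
  q ^ n * 1                                          ≡⟨ *-identityʳ (q ^ n) ⟩
  q ^ n                                              ∎
  where open ≡-Reasoning

winsAfter : ∀ {q m k} → Strat q m k → Vec (Response q) k → Vec (Fin q) m → Bool
winsAfter s h cfg = noWrong cfg (run s h cfg) ∧ someRight cfg (run s h cfg)

losesAfter : ∀ {q m k} → Strat q m k → Vec (Response q) k → Vec (Fin q) m → ℕ
losesAfter s h cfg = 𝟙 (not (winsAfter s h cfg))

guess-losesAllButOne : ∀ {p m} (cs : Vec (Fin (suc p)) m) g rs →
  p ≤ ∑[ c < suc p ] 𝟙 (not (noWrong (c ∷ cs) (just g ∷ rs) ∧ someRight (c ∷ cs) (just g ∷ rs)))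
guess-losesAllButOne cs g rs = allButOne≥1⇒p≤∑ _ g (λ c c≢g → ≤-reflexive (sym (wrongGuess-loses c c≢g)))
  where
  wrongGuess-loses : ∀ c → c ≢ g →
    𝟙 (not (noWrong (c ∷ cs) (just g ∷ rs) ∧ someRight (c ∷ cs) (just g ∷ rs))) ≡ 1
  wrongGuess-loses c c≢g with g ≟ c
  ... | yes g≡c = contradiction (sym g≡c) c≢g
  ... | no  _   = refl

losesAfter-∷-≥ : ∀ {p m k} (f : Vec (Response (suc p)) k → Vec (Fin (suc p)) m → Response (suc p))
  (s : Strat (suc p) m (suc k)) h cs →
  p * losesAfter s (h ∷ʳ nothing) cs ≤ ∑[ c < suc p ] losesAfter {m = suc m} (f , s) h (c ∷ cs)
losesAfter-∷-≥ {p} f s h cs with f h cs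
... | nothing = begin
  p * losesAfter s (h ∷ʳ nothing) cs             ≤⟨ *-monoˡ-≤ _ (n≤1+n p) ⟩
  suc p * losesAfter s (h ∷ʳ nothing) cs         ≡⟨ sym (∑-const (suc p) _) ⟩
  ∑[ c < suc p ] losesAfter s (h ∷ʳ nothing) cs  ∎
  where open ≤-Reasoning
... | just g = begin
  p * losesAfter s (h ∷ʳ nothing) cs  ≤⟨ *-monoʳ-≤ p (𝟙≤1 _) ⟩
  p * 1                               ≡⟨ *-identityʳ p ⟩
  p                                   ≤⟨ guess-losesAllButOne cs g (run s (h ∷ʳ just g) cs) ⟩
  _                                   ∎
  where open ≤-Reasoning

p^m≤sumConfigs-losesAfter : ∀ {p} m {k} (s : Strat (suc p) m k) h → p ^ m ≤ sumConfigs m (losesAfter s h)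
p^m≤sumConfigs-losesAfter zero s h = ≤-refl
p^m≤sumConfigs-losesAfter {p} (suc m) (f , s) h = begin
  p * p ^ m                                 ≤⟨ *-monoʳ-≤ p (p^m≤sumConfigs-losesAfter m s (h ∷ʳ nothing)) ⟩
  p * sumConfigs m tailLoses                ≡⟨ sym (*-distribˡ-sumConfigs m p tailLoses) ⟩
  sumConfigs m (λ cs → p * tailLoses cs)    ≤⟨ sumConfigs-mono-≤ m (losesAfter-∷-≥ f s h) ⟩
  sumConfigs m (λ cs → ∑[ c < suc p ] loses c cs)
                                            ≡⟨ sumConfigs-∑-comm m loses ⟩
  ∑[ c < suc p ] sumConfigs m (loses c)     ∎
  where
  open ≤-Reasoning
  tailLoses = losesAfter s (h ∷ʳ nothing)
  loses : Fin (suc p) → Vec (Fin (suc p)) m → ℕ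
  loses c cs = losesAfter {m = suc m} (f , s) h (c ∷ cs)

winCount-≤ : ∀ {p n} (s : Strategy (suc p) n) → winCount s ≤ suc p ^ n ∸ p ^ n
winCount-≤ {p} {n} s = begin
  winCount s                      ≡⟨ winCount≡sumConfigs s ⟩
  W                               ≡⟨ sym (m+n∸n≡m W L) ⟩
  W + L ∸ L                       ≡⟨ cong (_∸ L) (sumConfigs-𝟙-+-𝟙-not n (wins s)) ⟩
  suc p ^ n ∸ L                   ≤⟨ ∸-monoʳ-≤ (suc p ^ n) (p^m≤sumConfigs-losesAfter n s []) ⟩
  suc p ^ n ∸ p ^ n               ∎
  where
  open ≤-Reasoning
  W = sumConfigs n (𝟙 ∘ wins s)
  L = sumConfigs n (losesAfter s [])

isNonzero : ∀ {p} → Fin (suc p) → Bool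
isNonzero zero    = false
isNonzero (suc _) = true

allNonzero : ∀ {p m} → Vec (Fin (suc p)) m → Bool
allNonzero []       = true
allNonzero (c ∷ cs) = isNonzero c ∧ allNonzero cs

allPass : ∀ {q k} → Vec (Response q) k → Bool
allPass []       = true
allPass (r ∷ rs) = is-nothing r ∧ allPass rs

allPass-∷ʳ : ∀ {q k} (h : Vec (Response q) k) r → allPass (h ∷ʳ r) ≡ allPass h ∧ is-nothing r
allPass-∷ʳ []       r = ∧-identityʳ (is-nothing r)
allPass-∷ʳ (x ∷ h) r = trans (cong (is-nothing x ∧_) (allPass-∷ʳ h r)) (sym (∧-assoc (is-nothing x) _ _))

guessZero : ∀ {p} m k → Strat (suc p) m k
guessZero zero    k = tt
guessZero (suc m) k = (λ h cs → if allPass h ∧ allNonzero cs then just zero else nothing) , guessZero m (suc k)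

guessZero-silent : ∀ {p} m {k} (h : Vec (Response (suc p)) k) cfg →
  allPass h ≡ false → run (guessZero m k) h cfg ≡ replicate m nothing
guessZero-silent zero    h []       _ = refl
guessZero-silent (suc m) h (c ∷ cs) guessed rewrite guessed =
  cong (nothing ∷_) (guessZero-silent m (h ∷ʳ nothing) cs (trans (allPass-∷ʳ h nothing) (cong (_∧ true) guessed)))

noWrong-silent : ∀ {q m} (cfg : Vec (Fin q) m) → noWrong cfg (replicate m nothing) ≡ true
noWrong-silent []       = refl
noWrong-silent (c ∷ cs) = noWrong-silent cs

someRight-silent : ∀ {q m} (cfg : Vec (Fin q) m) → someRight cfg (replicate m nothing) ≡ false
someRight-silent []       = refl
someRight-silent (c ∷ cs) = someRight-silent cs

guessZero-wins : ∀ {p} m {k} (h : Vec (Response (suc p)) k) cfg →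
  allPass h ≡ true → winsAfter (guessZero m k) h cfg ≡ not (allNonzero cfg)
guessZero-wins zero    h []       _ = refl
guessZero-wins (suc m) h (c ∷ cs) silent rewrite silent with allNonzero cs in allNonzero-cs
... | true
  rewrite guessZero-silent m (h ∷ʳ just zero) cs (trans (allPass-∷ʳ h (just zero)) (∧-zeroʳ (allPass h)))
        | noWrong-silent cs | someRight-silent cs with c
... | zero  = refl
... | suc _ = refl
guessZero-wins (suc m) h (c ∷ cs) silent | false = begin
  winsAfter (guessZero m _) (h ∷ʳ nothing) cs  ≡⟨ guessZero-wins m (h ∷ʳ nothing) cs stillSilent ⟩
  not (allNonzero cs)                          ≡⟨ cong not allNonzero-cs ⟩
  true                                         ≡⟨ cong not (sym (∧-zeroʳ (isNonzero c))) ⟩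
  not (isNonzero c ∧ false)                    ∎
  where
  open ≡-Reasoning
  stillSilent = trans (allPass-∷ʳ h nothing) (cong (_∧ true) silent)

noWrong-lookup : ∀ {q m} (cfg : Vec (Fin q) m) rs → noWrong cfg rs ≡ true →
  ∀ i {g} → lookup rs i ≡ just g → g ≡ lookup cfg i
noWrong-lookup (c ∷ cs) (nothing ∷ rs) ok (suc i) rᵢ≡g = noWrong-lookup cs rs ok i rᵢ≡g
noWrong-lookup (c ∷ cs) (just g′ ∷ rs) ok i rᵢ≡g with g′ ≟ c | i
... | yes refl | zero  = sym (just-injective rᵢ≡g)
... | yes refl | suc j = noWrong-lookup cs rs ok j rᵢ≡g

guessZero-restricted : ∀ {p} n → Restricted (guessZero {p} n 0)
guessZero-restricted (suc n) (c ∷ cs) (suc j) g _ rⱼ≡g with allNonzero cs in allNonzero-cs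
... | true rewrite guessZero-silent n (just zero ∷ []) cs refl
  = contradiction (trans (sym (lookup-replicate j nothing)) rⱼ≡g) λ ()
... | false = noWrong-lookup cs _ noWrong-tail j rⱼ≡g
  where
  noWrong-tail = ∧-conicalˡ _ _ (trans (guessZero-wins n (nothing ∷ []) cs refl) (cong not allNonzero-cs))

sumConfigs-allNonzero : ∀ {p} n → sumConfigs n (𝟙 ∘ allNonzero {p}) ≡ p ^ n
sumConfigs-allNonzero         zero    = refl
sumConfigs-allNonzero {p = p} (suc n) = begin
  sumConfigs n (λ _ → 0) + ∑[ c < p ] sumConfigs n (𝟙 ∘ allNonzero)
    ≡⟨ cong₂ _+_ (sumConfigs-const n 0) (sum-cong-≗ {p} (λ _ → sumConfigs-allNonzero n)) ⟩
  suc p ^ n * 0 + ∑[ c < p ] (p ^ n)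
    ≡⟨ cong₂ _+_ (*-zeroʳ (suc p ^ n)) (∑-const p (p ^ n)) ⟩
  p * p ^ n ∎
  where open ≡-Reasoning

winCount-guessZero : ∀ {p} n → winCount (guessZero {p} n 0) ≡ suc p ^ n ∸ p ^ n
winCount-guessZero {p} n = begin
  winCount (guessZero n 0)                ≡⟨ winCount≡sumConfigs (guessZero n 0) ⟩
  sumConfigs n (𝟙 ∘ wins (guessZero n 0)) ≡⟨ sumConfigs-cong n (λ cfg → cong 𝟙 (guessZero-wins n [] cfg refl)) ⟩
  B                                       ≡⟨ sym (m+n∸m≡n A B) ⟩
  A + B ∸ A                               ≡⟨ cong₂ _∸_ (sumConfigs-𝟙-+-𝟙-not n allNonzero) (sumConfigs-allNonzero n) ⟩
  suc p ^ n ∸ p ^ n                       ∎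
  where
  open ≡-Reasoning
  A = sumConfigs n (𝟙 ∘ allNonzero {p})
  B = sumConfigs n (𝟙 ∘ not ∘ allNonzero {p})

toℚᵘ-frac : ∀ a d → toℚᵘ (frac a (suc d)) ≃ᵘ mkℚᵘ (ℤ.+ a) d
toℚᵘ-frac a d = toℚᵘ-fromℚᵘ (mkℚᵘ (ℤ.+ a) d)

frac-* : ∀ a b D E .{{_ : NonZero D}} .{{E≢0 : NonZero E}} → frac a D ℚ.* frac b E ≡ frac (a * b) (D * E)
frac-* a b (suc d) (suc e) = toℚᵘ-injective (begin
  toℚᵘ (frac a (suc d) ℚ.* frac b (suc e))        ≈⟨ toℚᵘ-homo-* (frac a (suc d)) (frac b (suc e)) ⟩
  toℚᵘ (frac a (suc d)) *ᵘ toℚᵘ (frac b (suc e))  ≈⟨ *-cong (toℚᵘ-frac a d) (toℚᵘ-frac b e) ⟩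
  mkℚᵘ (ℤ.+ a) d *ᵘ mkℚᵘ (ℤ.+ b) e                ≡⟨ cong (λ i → mkℚᵘ i _) (sym (pos-* a b)) ⟩
  mkℚᵘ (ℤ.+ (a * b)) _                            ≈⟨ ≃-sym (toℚᵘ-frac (a * b) _) ⟩
  toℚᵘ (frac (a * b) (suc d * suc e))             ∎)
  where open ≃-Reasoning

powℚ-frac : ∀ a D n .{{_ : NonZero D}} → powℚ (frac a D) n ≡ frac (a ^ n) (D ^ n)
powℚ-frac a D zero    = refl
powℚ-frac a D (suc n) = trans (cong (frac a D ℚ.*_) (powℚ-frac a D n))
                              (frac-* a (a ^ n) D (D ^ n) {{E≢0 = m^n≢0 D n}})

mkℚᵘ≃1-mkℚᵘ : ∀ w b d → w + b ≡ suc d → mkℚᵘ (ℤ.+ w) d ≃ᵘ 1ℚᵘ -ᵘ mkℚᵘ (ℤ.+ b) d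
mkℚᵘ≃1-mkℚᵘ w b d w+b≡D = *≡* (trans (cong (λ n → ℤ.+ w ℤ.* ℤ.+ n) (*-identityˡ (suc d)))
                               (cross (ℤ.+ w) (ℤ.+ b) (trans (cong ℤ.+_ (sym w+b≡D)) (pos-+ w b))))
  where
  ring : ∀ x y → x ℤ.* (x ℤ.+ y) ≡ (ℤ.+ 1 ℤ.* (x ℤ.+ y) ℤ.+ ℤ.- y ℤ.* ℤ.+ 1) ℤ.* (x ℤ.+ y)
  ring = solve-∀
  cross : ∀ x y {D} → D ≡ x ℤ.+ y → x ℤ.* D ≡ (ℤ.+ 1 ℤ.* D ℤ.+ ℤ.- y ℤ.* ℤ.+ 1) ℤ.* D
  cross x y refl = ring x y

frac-∸ : ∀ b D .{{_ : NonZero D}} → b ≤ D → frac (D ∸ b) D ≡ 1ℚ - frac b D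
frac-∸ b D@(suc d) b≤D = toℚᵘ-injective (begin
  toℚᵘ (frac (D ∸ b) D)           ≈⟨ toℚᵘ-frac (D ∸ b) d ⟩
  mkℚᵘ (ℤ.+ (D ∸ b)) d            ≈⟨ mkℚᵘ≃1-mkℚᵘ (D ∸ b) b d (m∸n+n≡m b≤D) ⟩
  1ℚᵘ -ᵘ mkℚᵘ (ℤ.+ b) d           ≈⟨ +-cong (≃-refl {1ℚᵘ}) (-‿cong (≃-sym (toℚᵘ-frac b d))) ⟩
  toℚᵘ 1ℚ +ᵘ -ᵘ toℚᵘ (frac b D)   ≈⟨ +-cong (≃-refl {toℚᵘ 1ℚ}) (≃-sym (toℚᵘ-homo‿- (frac b D))) ⟩
  toℚᵘ 1ℚ +ᵘ toℚᵘ (ℚ.- frac b D)  ≈⟨ ≃-sym (toℚᵘ-homo-+ 1ℚ (ℚ.- frac b D)) ⟩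
  toℚᵘ (1ℚ - frac b D)            ∎)
  where open ≃-Reasoning

frac-mono-≤ : ∀ {a b} D → a ≤ b → frac a D ℚ.≤ frac b D
frac-mono-≤         zero    _   = ≤ℚ-refl
frac-mono-≤ {a} {b} (suc d) a≤b = toℚᵘ-cancel-≤
  (≤-respˡ-≃ (≃-sym (toℚᵘ-frac a d)) (≤-respʳ-≃ (≃-sym (toℚᵘ-frac b d))
    (*≤* (*-monoʳ-≤-nonNeg (ℤ.+ suc d) (ℤ.+≤+ a≤b)))))

lemma5 : (q n : ℕ) → 1 < q → 1 ≤ n →
    Σ (Strategy q n) (λ s → Restricted s × successProb s ≡ 1ℚ - powℚ (frac (q ∸ 1) q) n)
    × ((s : Strategy q n) → Restricted s →
    successProb s Data.Rational.≤ 1ℚ - powℚ (frac (q ∸ 1) q) n)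
lemma5 zero    n () _
lemma5 (suc p) n _  _ =
  (guessZero n 0 , guessZero-restricted n , optimal) , λ s _ → bounded s
  where
  q = suc p

  value : frac (q ^ n ∸ p ^ n) (q ^ n) ≡ 1ℚ - powℚ (frac p q) n
  value = trans (frac-∸ (p ^ n) (q ^ n) {{m^n≢0 q n}} (^-monoˡ-≤ n (n≤1+n p)))
                (cong (1ℚ -_) (sym (powℚ-frac p q n)))

  optimal : successProb (guessZero n 0) ≡ 1ℚ - powℚ (frac p q) n
  optimal = trans (cong (λ w → frac w (q ^ n)) (winCount-guessZero n)) value

  bounded : (s : Strategy q n) → successProb s ℚ.≤ 1ℚ - powℚ (frac p q) n
  bounded s = subst (successProb s ℚ.≤_) value (frac-mono-≤ (q ^ n) (winCount-≤ s))
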